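{- Let $p=(12,\{(0,1),(0,2),(1,0),(1,1),(1,2)\})$. A permutation $\pi\in S_n$ avoids $p$ if and only if for every ascent $\pi_i<\pi_{i+1}$ of $\pi$ there is an index $k<i$ with $\pi_k>\pi_{i+1}$ (so that $\pi_k\pi_i\pi_{i+1}$ is a $312$ pattern whose $12$ is the ascent) or with $\pi_i<\pi_k<\pi_{i+1}$ (so that $\pi_k\pi_i\pi_{i+1}$ is a $213$ pattern whose $13$ is the ascent), or both. Writing $a_n=|S_n(p)|$, we have $a_0=a_1=1$ and $a_n=(n-1)a_{n-1}+(n-2)a_{n-2}$ for $n\ge2$. Furthermore, for $n\ge 1$, \[a_n=\sum_{k=0}^{n-1}(-1)^k (n-k)\frac{(n-1)!}{k!}.\]
   Context: $S_n$ is the set of permutations of $\{1,\dots,n\}$, written $\pi=\pi_1\cdots\pi_n$; an ascent is an index $i$ with $\pi_i<\pi_{i+1}$. A mesh pattern $(12,R)$ of length 2 has $R\subseteq\{0,1,2\}^2$ (shaded boxes). A permutation $\pi\in S_n$ contains $(12,R)$ if there exist indices $i<j$ with $\pi_i<\pi_j$ such that, with $p_0=0,p_1=i,p_2=j,p_3=n+1$ and $v_0=0,v_1=\pi_i,v_2=\pi_j,v_3=n+1$, for every $(a,b)\in R$ there is no index $x$ with $p_a<x<p_{a+1}$ and $v_b<\pi_x<v_{b+1}$. Otherwise $\pi$ avoids it; $S_n(p)$ is the set of avoiders in $S_n$. -}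

module Defs where

open import Data.Nat using (ℕ; zero; suc; _+_; _∸_; _<_; _!; _/_)
open import Data.Nat.Properties using (_!≢0)
open import Data.Fin using (Fin; toℕ)
open import Data.Vec using (Vec; lookup)
open import Data.List using (List; []; _∷_; length; map; upTo; foldr)
open import Data.List.Membership.Propositional using (_∈_)
open import Data.List.Relation.Unary.Unique.Propositional using (Unique)
open import Data.Product using (Σ; ∃; _×_; _,_)
open import Data.Sum using (_⊎_)
open import Relation.Nullary using (¬_)
open import Relation.Binary.PropositionalEquality using (_≡_)
open import Function.Bundles using (_⇔_)
open import Data.Integer as ℤ using (ℤ; +_; -[1+_])

-- A permutation of {1..n} in one-line notation, 0-based:
-- position x : Fin n (paper index toℕ x + 1), value lookup π x (paper value toℕ (lookup π x) + 1).
IsPerm : ∀ {n} → Vec (Fin n) n → Set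
IsPerm {n} π = ∀ (i j : Fin n) → lookup π i ≡ lookup π j → i ≡ j

pos : ∀ {n} → Fin n → ℕ
pos x = suc (toℕ x)

val : ∀ {n} → Vec (Fin n) n → Fin n → ℕ
val π x = suc (toℕ (lookup π x))

-- boundaries p_0..p_3 and v_0..v_3 for an occurrence at indices i < j
bnd : ∀ {n} → ℕ → ℕ → Fin 4 → ℕ
bnd {n} a b Fin.zero = 0
bnd {n} a b (Fin.suc Fin.zero) = a
bnd {n} a b (Fin.suc (Fin.suc Fin.zero)) = b
bnd {n} a b (Fin.suc (Fin.suc (Fin.suc Fin.zero))) = suc n

inj : Fin 3 → Fin 4
inj = Data.Fin.inject₁

nxt : Fin 3 → Fin 4
nxt = Fin.suc

BoxEmpty : ∀ {n} → Vec (Fin n) n → Fin n → Fin n → Fin 3 × Fin 3 → Set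
BoxEmpty {n} π i j (a , b) =
  ¬ (Σ (Fin n) λ x →
       (bnd {n} (pos i) (pos j) (inj a) < pos x × pos x < bnd {n} (pos i) (pos j) (nxt a))
     × (bnd {n} (val π i) (val π j) (inj b) < val π x × val π x < bnd {n} (val π i) (val π j) (nxt b)))

Contains12 : ∀ {n} → List (Fin 3 × Fin 3) → Vec (Fin n) n → Set
Contains12 {n} R π =
  Σ (Fin n) λ i → Σ (Fin n) λ j →
    toℕ i < toℕ j × val π i < val π j × (∀ box → box ∈ R → BoxEmpty π i j box)

Avoids12 : ∀ {n} → List (Fin 3 × Fin 3) → Vec (Fin n) n → Set
Avoids12 R π = ¬ Contains12 R π

b0 b1 b2 : Fin 3
b0 = Fin.zero
b1 = Fin.suc Fin.zero
b2 = Fin.suc (Fin.suc Fin.zero)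

Rp : List (Fin 3 × Fin 3)
Rp = (b0 , b1) ∷ (b0 , b2) ∷ (b1 , b0) ∷ (b1 , b1) ∷ (b1 , b2) ∷ []

AvoiderCount : List (Fin 3 × Fin 3) → ℕ → ℕ → Set
AvoiderCount R n m =
  Σ (List (Vec (Fin n) n)) λ L →
    Unique L × (∀ π → (π ∈ L) ⇔ (IsPerm π × Avoids12 R π)) × length L ≡ m

AscentCondition : ∀ {n} → Vec (Fin n) n → Set
AscentCondition {n} π =
  ∀ (i j : Fin n) → toℕ j ≡ suc (toℕ i) → val π i < val π j →
    Σ (Fin n) λ k → toℕ k < toℕ i ×
      (val π j < val π k ⊎ (val π i < val π k × val π k < val π j))

-- (n-1)! / k!  (exact division in ℕ for k ≤ n-1)
factQuot : ℕ → ℕ → ℕ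
factQuot m k = _/_ (m !) (k !) {{k !≢0}}

sumℤ : List ℤ → ℤ
sumℤ = foldr ℤ._+_ (+ 0)

formula : ℕ → ℤ
formula n = sumℤ (map (λ k → (-[1+ 0 ] ℤ.^ k) ℤ.* (+ (n ∸ k)) ℤ.* (+ factQuot (n ∸ 1) k)) (upTo n))

-- An occurrence of the pattern must sit on an ascent π_i < π_{i+1}, since any entry strictly
-- between its two positions lies in one of the shaded boxes (1,0), (1,1), (1,2); the remaining
-- shaded boxes (0,1), (0,2) then say that no earlier entry exceeds π_i.  So π avoids the pattern
-- iff every ascent has an earlier entry larger than its bottom, which is the ascent condition.
--
-- Avoiders are generated by appending a last value v to an avoider τ of length n and shifting
-- the entries ≥ v up.  This keeps the property, except that v = n + 1 creates an uncovered ascent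
-- exactly when τ ends with its own maximum.  Each avoider of length n has n extensions not ending
-- with the maximum, so writing b_n for the avoiders not ending with their maximum,
-- b_{n+1} = n a_n and a_{n+1} = n a_n + b_n, whence a_{n+2} = (n+1) a_{n+1} + n a_n.
--
-- The alternating sum equals D_{n-1} + D_n, where D_m = Σ_k (-1)^k m!/k! are the derangement
-- numbers, and D_{m+2} = (m+1)(D_{m+1} + D_m) shows that it obeys the same recurrence.

module Submission where

open import Defs
open import Data.Nat as ℕ using (ℕ; zero; suc; _+_; _*_; _∸_; _≥_; _!; z<s; s<s; s≤s; s<s⁻¹)
import Data.Nat.Properties as ℕ
open import Data.Nat.DivMod using (n/n≡1; *-/-assoc)
open import Data.Nat.Divisibility using (m≤n⇒m!∣n!)
open import Data.Integer as ℤ using (ℤ; +_; -[1+_])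
import Data.Integer.Properties as ℤ
open import Data.Integer.Tactic.RingSolver using (solve-∀)
open import Data.Fin as Fin using (Fin; toℕ; fromℕ; fromℕ<; inject₁; punchIn; punchOut; _<_; _≟_)
open import Data.Fin.Properties as Fin
  using (any?; toℕ<n; toℕ-fromℕ<; toℕ-inject₁; toℕ-fromℕ; ≤fromℕ; fromℕ≢inject₁; inject₁-injective;
         toℕ-injective; punchIn-injective; punchInᵢ≢i; punchOut-injective; punchIn-punchOut; injective⇒≤)
open import Data.Fin.Relation.Unary.Top using (view; ‵fromℕ; ‵inject₁)
open import Data.Vec as Vec using (Vec; lookup; _∷ʳ_; tabulate)
open import Data.Vec.Properties using (lookup-map; lookup∘tabulate; ∷ʳ-injective)
open import Data.Vec.Relation.Binary.Pointwise.Extensional using (ext; Pointwise-≡⇒≡)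
open import Data.List using (List; []; _∷_; [_]; _++_; map; concatMap; allFin; applyUpTo; length)
open import Data.List.Properties using (length-++; length-map; length-tabulate)
open import Data.List.Membership.Propositional using (_∈_; find; lose)
open import Data.List.Membership.Propositional.Properties
  using (∈-map⁺; ∈-map⁻; ∈-++⁺ˡ; ∈-++⁺ʳ; ∈-++⁻; ∈-allFin; ∈-concatMap⁺; ∈-concatMap⁻)
import Data.List.Relation.Unary.All as All
import Data.List.Relation.Unary.All.Properties as All
open import Data.List.Relation.Unary.AllPairs as AllPairs using ([]; _∷_)
import Data.List.Relation.Unary.AllPairs.Properties as AllPairs
open import Data.List.Relation.Unary.Any using (here; there)
open import Data.List.Relation.Unary.Unique.Propositional using (Unique)
open import Data.List.Relation.Unary.Unique.Propositional.Properties as Unique using (allFin⁺)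
open import Algebra.Properties.Semiring.Sum ℤ.+-*-semiring
  using (sum; sum-init-last; sum-cong-≗; ∑-distrib-+; *-distribˡ-sum)
open import Algebra.Properties.CommutativeSemigroup ℤ.*-commutativeSemigroup using (x∙yz≈y∙xz)
open import Data.Product using (Σ; ∃; ∃₂; _×_; _,_; proj₁; proj₂)
open import Data.Sum using (inj₁; inj₂)
open import Data.Empty using (⊥; ⊥-elim)
open import Relation.Nullary using (¬_; yes; no; contradiction)
open import Relation.Nullary.Decidable using (_×-dec_)
open import Relation.Binary.Definitions using (tri<; tri≈; tri>)
open import Relation.Binary.PropositionalEquality
  using (_≡_; _≢_; refl; sym; trans; cong; cong₂; subst; module ≡-Reasoning)
open import Function using (_∘_)
open import Function.Bundles using (_⇔_; mk⇔; Equivalence)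
open import Function.Definitions using (Injective)
import Function.Properties.Equivalence as ⇔
open Equivalence using (to; from)

-- Avoiders and the ascent condition

EarlierLargerAtAscents : ∀ {n} → Vec (Fin n) n → Set
EarlierLargerAtAscents {n} π =
  ∀ (i j : Fin n) → toℕ j ≡ suc (toℕ i) → lookup π i < lookup π j →
    ∃ λ k → k < i × lookup π i < lookup π k

adjacent⇒< : ∀ {n} {i j : Fin n} → toℕ j ≡ suc (toℕ i) → i < j
adjacent⇒< j≡1+i = ℕ.≤-reflexive (sym j≡1+i)

earlierLargerAtAscents⇔ascentCondition : ∀ {n} (π : Vec (Fin n) n) → IsPerm π →
  EarlierLargerAtAscents π ⇔ AscentCondition π
earlierLargerAtAscents⇔ascentCondition π perm = mk⇔ ⇒ ⇐
  where
  ⇒ : EarlierLargerAtAscents π → AscentCondition π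
  ⇒ larger i j j≡1+i (s<s πi<πj) with larger i j j≡1+i πi<πj
  ... | k , k<i , πi<πk with Fin.<-cmp (lookup π k) (lookup π j)
  ... | tri< πk<πj _ _ = k , k<i , inj₂ (s<s πi<πk , s<s πk<πj)
  ... | tri> _ _ πj<πk = k , k<i , inj₁ (s<s πj<πk)
  ... | tri≈ _ πk≡πj _ = contradiction (ℕ.<-trans k<i (adjacent⇒< j≡1+i)) (Fin.<-irrefl (perm k j πk≡πj))
  ⇐ : AscentCondition π → EarlierLargerAtAscents π
  ⇐ ascent i j j≡1+i πi<πj with ascent i j j≡1+i (s<s πi<πj)
  ... | k , k<i , inj₁ πj<πk = k , k<i , Fin.<-trans πi<πj (s<s⁻¹ πj<πk)
  ... | k , k<i , inj₂ (πi<πk , _) = k , k<i , s<s⁻¹ πi<πk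

-- An entry strictly between the two positions of an occurrence would lie in one of the
-- shaded boxes (1,0), (1,1), (1,2), according to its value.
occurrence-nothing-between : ∀ {n} (π : Vec (Fin n) n) → IsPerm π → ∀ {i j} →
  (∀ box → box ∈ Rp → BoxEmpty π i j box) → ∀ x → i < x → x < j → ⊥
occurrence-nothing-between π perm {i} {j} empty x i<x x<j with Fin.<-cmp (lookup π x) (lookup π i)
... | tri< πx<πi _ _ = empty (b1 , b0) (there (there (here refl)))
                        (x , (s<s i<x , s<s x<j) , (z<s , s<s πx<πi))
... | tri≈ _ πx≡πi _ = Fin.<⇒≢ i<x (sym (perm x i πx≡πi))
... | tri> _ _ πi<πx with Fin.<-cmp (lookup π x) (lookup π j)
...   | tri< πx<πj _ _ = empty (b1 , b1) (there (there (there (here refl))))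
                          (x , (s<s i<x , s<s x<j) , (s<s πi<πx , s<s πx<πj))
...   | tri≈ _ πx≡πj _ = Fin.<⇒≢ x<j (perm x j πx≡πj)
...   | tri> _ _ πj<πx = empty (b1 , b2) (there (there (there (there (here refl)))))
                          (x , (s<s i<x , s<s x<j) , (s<s πj<πx , s<s (toℕ<n (lookup π x))))

occurrence-adjacent : ∀ {n} (π : Vec (Fin n) n) → IsPerm π → ∀ {i j} → i < j →
  (∀ box → box ∈ Rp → BoxEmpty π i j box) → toℕ j ≡ suc (toℕ i)
occurrence-adjacent {n} π perm {i} {j} i<j empty with ℕ.m≤n⇒m<n∨m≡n i<j
... | inj₂ j≡1+i = sym j≡1+i
... | inj₁ 1+i<j = ⊥-elim (occurrence-nothing-between π perm empty x i<x x<j)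
  where
  x : Fin n
  x = fromℕ< (ℕ.<-≤-trans 1+i<j (ℕ.<⇒≤ (toℕ<n j)))
  i<x : i < x
  i<x = ℕ.≤-reflexive (sym (toℕ-fromℕ< _))
  x<j : x < j
  x<j = subst (ℕ._< toℕ j) (sym (toℕ-fromℕ< _)) 1+i<j

avoids⇔earlierLargerAtAscents : ∀ {n} (π : Vec (Fin n) n) → IsPerm π →
  Avoids12 Rp π ⇔ EarlierLargerAtAscents π
avoids⇔earlierLargerAtAscents π perm = mk⇔ ⇒ ⇐
  where
  ⇒ : Avoids12 Rp π → EarlierLargerAtAscents π
  ⇒ avoids i j j≡1+i πi<πj with any? (λ k → (k Fin.<? i) ×-dec (lookup π i Fin.<? lookup π k))
  ... | yes found = found
  ... | no none = contradiction (i , j , adjacent⇒< j≡1+i , s<s πi<πj , empty) avoids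
    where
    between : ∀ {x} → i < x → x < j → ⊥
    between i<x x<j = ℕ.<⇒≱ i<x (ℕ.s≤s⁻¹ (subst (toℕ _ ℕ.<_) j≡1+i x<j))
    empty : ∀ box → box ∈ Rp → BoxEmpty π i j box
    empty _ (here refl) (k , (_ , k<i) , (πi<πk , _)) = none (k , s<s⁻¹ k<i , s<s⁻¹ πi<πk)
    empty _ (there (here refl)) (k , (_ , k<i) , (πj<πk , _)) =
      none (k , s<s⁻¹ k<i , Fin.<-trans πi<πj (s<s⁻¹ πj<πk))
    empty _ (there (there (here refl))) (x , (i<x , x<j) , _) = between (s<s⁻¹ i<x) (s<s⁻¹ x<j)
    empty _ (there (there (there (here refl)))) (x , (i<x , x<j) , _) = between (s<s⁻¹ i<x) (s<s⁻¹ x<j)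
    empty _ (there (there (there (there (here refl))))) (x , (i<x , x<j) , _) = between (s<s⁻¹ i<x) (s<s⁻¹ x<j)
  ⇐ : EarlierLargerAtAscents π → Avoids12 Rp π
  ⇐ larger (i , j , i<j , s<s πi<πj , empty) with larger i j j≡1+i πi<πj
    where j≡1+i = occurrence-adjacent π perm i<j empty
  ... | k , k<i , πi<πk with Fin.<-cmp (lookup π k) (lookup π j)
  ... | tri< πk<πj _ _ = empty (b0 , b1) (here refl) (k , (z<s , s<s k<i) , (s<s πi<πk , s<s πk<πj))
  ... | tri> _ _ πj<πk =
    empty (b0 , b2) (there (here refl)) (k , (z<s , s<s k<i) , (s<s πj<πk , s<s (toℕ<n (lookup π k))))
  ... | tri≈ _ πk≡πj _ = Fin.<-irrefl (perm k j πk≡πj) (Fin.<-trans k<i i<j)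

avoids⇔ascentCondition : ∀ {n} (π : Vec (Fin n) n) → IsPerm π → Avoids12 Rp π ⇔ AscentCondition π
avoids⇔ascentCondition π perm =
  ⇔.trans (avoids⇔earlierLargerAtAscents π perm) (earlierLargerAtAscents⇔ascentCondition π perm)

-- Extending a permutation by a last entry

lookup-∷ʳ-inject₁ : ∀ {A : Set} {n} (xs : Vec A n) x i → lookup (xs ∷ʳ x) (inject₁ i) ≡ lookup xs i
lookup-∷ʳ-inject₁ (y Vec.∷ xs) x Fin.zero    = refl
lookup-∷ʳ-inject₁ (y Vec.∷ xs) x (Fin.suc i) = lookup-∷ʳ-inject₁ xs x i

lookup-∷ʳ-fromℕ : ∀ {A : Set} {n} (xs : Vec A n) x → lookup (xs ∷ʳ x) (fromℕ n) ≡ x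
lookup-∷ʳ-fromℕ Vec.[]         x = refl
lookup-∷ʳ-fromℕ (y Vec.∷ xs) x = lookup-∷ʳ-fromℕ xs x

fromℕ≮ : ∀ {n} (i : Fin (suc n)) → ¬ fromℕ n < i
fromℕ≮ i = ℕ.≤⇒≯ (≤fromℕ i)

<fromℕ : ∀ {n} {i : Fin (suc n)} → i ≢ fromℕ n → i < fromℕ n
<fromℕ {i = i} = Fin.≤∧≢⇒< (≤fromℕ i)

punchIn-mono-< : ∀ {n} (v : Fin (suc n)) {i j : Fin n} → i < j → punchIn v i < punchIn v j
punchIn-mono-< Fin.zero    i<j = ℕ.s≤s i<j
punchIn-mono-< (Fin.suc v) {Fin.zero}  {Fin.suc j} i<j = ℕ.z<s
punchIn-mono-< (Fin.suc v) {Fin.suc i} {Fin.suc j} i<j = ℕ.s<s (punchIn-mono-< v (ℕ.s<s⁻¹ i<j))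

punchIn-cancel-< : ∀ {n} (v : Fin (suc n)) {i j : Fin n} → punchIn v i < punchIn v j → i < j
punchIn-cancel-< Fin.zero    i<j = ℕ.s<s⁻¹ i<j
punchIn-cancel-< (Fin.suc v) {Fin.zero}  {Fin.suc j} i<j = ℕ.z<s
punchIn-cancel-< (Fin.suc v) {Fin.suc i} {Fin.suc j} i<j = ℕ.s<s (punchIn-cancel-< v (ℕ.s<s⁻¹ i<j))

punchIn-fromℕ : ∀ {n} {v : Fin (suc (suc n))} → v ≢ fromℕ (suc n) → punchIn v (fromℕ n) ≡ fromℕ (suc n)
punchIn-fromℕ {n}     {Fin.zero}  _ = refl
punchIn-fromℕ {zero}  {Fin.suc Fin.zero} v≢max = contradiction refl v≢max
punchIn-fromℕ {suc n} {Fin.suc v} v≢max = cong Fin.suc (punchIn-fromℕ (v≢max ∘ cong Fin.suc))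

injective⇒surjective : ∀ {n} {f : Fin n → Fin n} → Injective _≡_ _≡_ f → ∀ y → ∃ λ x → f x ≡ y
injective⇒surjective {suc n} {f} f-injective y with any? (λ x → f x ≟ y)
... | yes found = found
... | no missed = contradiction (injective⇒≤ punchOut∘f-injective) ℕ.1+n≰n
  where
  y≢f : ∀ x → y ≢ f x
  y≢f x = missed ∘ (x ,_) ∘ sym
  punchOut∘f-injective : Injective _≡_ _≡_ (λ x → punchOut (y≢f x))
  punchOut∘f-injective {x} {x′} = f-injective ∘ punchOut-injective (y≢f x) (y≢f x′)

extend : ∀ {n} → Vec (Fin n) n → Fin (suc n) → Vec (Fin (suc n)) (suc n)
extend τ v = Vec.map (punchIn v) τ ∷ʳ v

module _ {n} (τ : Vec (Fin n) n) (v : Fin (suc n)) where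

  lookup-extend-inject₁ : ∀ i → lookup (extend τ v) (inject₁ i) ≡ punchIn v (lookup τ i)
  lookup-extend-inject₁ i = trans (lookup-∷ʳ-inject₁ (Vec.map (punchIn v) τ) v i) (lookup-map i (punchIn v) τ)

  lookup-extend-fromℕ : lookup (extend τ v) (fromℕ n) ≡ v
  lookup-extend-fromℕ = lookup-∷ʳ-fromℕ (Vec.map (punchIn v) τ) v

  extend-<⇔ : ∀ i j →
    lookup (extend τ v) (inject₁ i) < lookup (extend τ v) (inject₁ j) ⇔ lookup τ i < lookup τ j
  extend-<⇔ i j rewrite lookup-extend-inject₁ i | lookup-extend-inject₁ j =
    mk⇔ (punchIn-cancel-< v) (punchIn-mono-< v)

  extend-perm : IsPerm τ → IsPerm (extend τ v)
  extend-perm perm x y eq with view x | view y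
  ... | ‵fromℕ     | ‵fromℕ     = refl
  ... | ‵inject₁ i | ‵inject₁ j = cong inject₁ (perm i j (punchIn-injective v _ _
    (trans (sym (lookup-extend-inject₁ i)) (trans eq (lookup-extend-inject₁ j)))))
  ... | ‵inject₁ i | ‵fromℕ     =
    contradiction (trans (sym (lookup-extend-inject₁ i)) (trans eq lookup-extend-fromℕ)) (punchInᵢ≢i v _)
  ... | ‵fromℕ     | ‵inject₁ j =
    contradiction (trans (sym (lookup-extend-inject₁ j)) (trans (sym eq) lookup-extend-fromℕ)) (punchInᵢ≢i v _)

extend-injective : ∀ {n} {τ τ′ : Vec (Fin n) n} {v v′} →
  extend τ v ≡ extend τ′ v′ → τ ≡ τ′ × v ≡ v′
extend-injective {τ = τ} {τ′} {v} eq with ∷ʳ-injective _ _ eq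
... | map-eq , refl = Pointwise-≡⇒≡ (ext λ i → punchIn-injective v _ _ (begin
  punchIn v (lookup τ i)              ≡⟨ lookup-map i (punchIn v) τ ⟨
  lookup (Vec.map (punchIn v) τ) i   ≡⟨ cong (λ xs → lookup xs i) map-eq ⟩
  lookup (Vec.map (punchIn v) τ′) i  ≡⟨ lookup-map i (punchIn v) τ′ ⟩
  punchIn v (lookup τ′ i)             ∎)) , refl
  where open ≡-Reasoning

extend-surjective : ∀ {n} {π : Vec (Fin (suc n)) (suc n)} → IsPerm π →
  ∃₂ λ τ v → IsPerm τ × π ≡ extend τ v
extend-surjective {n} {π} perm = τ , v , τ-perm , Pointwise-≡⇒≡ (ext π≗extend)
  where
  v = lookup π (fromℕ n)
  v≢ : ∀ i → v ≢ lookup π (inject₁ i)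
  v≢ i = fromℕ≢inject₁ ∘ perm _ _
  τ : Vec (Fin n) n
  τ = tabulate (λ i → punchOut (v≢ i))
  τ-perm : IsPerm τ
  τ-perm i j eq = inject₁-injective (perm _ _ (punchOut-injective (v≢ i) (v≢ j)
    (trans (sym (lookup∘tabulate _ i)) (trans eq (lookup∘tabulate _ j)))))
  π≗extend : ∀ x → lookup π x ≡ lookup (extend τ v) x
  π≗extend x with view x
  ... | ‵fromℕ     = sym (lookup-extend-fromℕ τ v)
  ... | ‵inject₁ i = sym (begin
    lookup (extend τ v) (inject₁ i)  ≡⟨ lookup-extend-inject₁ τ v i ⟩
    punchIn v (lookup τ i)          ≡⟨ cong (punchIn v) (lookup∘tabulate _ i) ⟩
    punchIn v (punchOut (v≢ i))      ≡⟨ punchIn-punchOut (v≢ i) ⟩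
    lookup π (inject₁ i)            ∎)
    where open ≡-Reasoning

-- The empty permutation counts as not ending with its maximum, so that appending 1 to it is allowed.
EndsWithMax : ∀ {n} → Vec (Fin n) n → Set
EndsWithMax {zero}  _ = ⊥
EndsWithMax {suc n} π = lookup π (fromℕ n) ≡ fromℕ n

extend-endsWithMax⇔ : ∀ {n} (τ : Vec (Fin n) n) v → EndsWithMax (extend τ v) ⇔ v ≡ fromℕ n
extend-endsWithMax⇔ τ v = mk⇔ (trans (sym (lookup-extend-fromℕ τ v))) (trans (lookup-extend-fromℕ τ v))

inject₁-<⇔ : ∀ {n} {i j : Fin n} → inject₁ i < inject₁ j ⇔ i < j
inject₁-<⇔ {i = i} {j} rewrite toℕ-inject₁ i | toℕ-inject₁ j = mk⇔ (λ p → p) (λ p → p)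

inject₁-adjacent⇔ : ∀ {n} {i j : Fin n} →
  toℕ (inject₁ j) ≡ suc (toℕ (inject₁ i)) ⇔ toℕ j ≡ suc (toℕ i)
inject₁-adjacent⇔ {i = i} {j} rewrite toℕ-inject₁ i | toℕ-inject₁ j = mk⇔ (λ p → p) (λ p → p)

fromℕ-adjacent⇔ : ∀ {m} {i : Fin (suc (suc m))} →
  toℕ (fromℕ (suc m)) ≡ suc (toℕ i) ⇔ i ≡ inject₁ (fromℕ m)
fromℕ-adjacent⇔ {m} = mk⇔
  (λ eq → toℕ-injective (trans (sym (ℕ.suc-injective eq)) (sym (toℕ-inject₁ (fromℕ m)))))
  (λ { refl → cong suc (sym (toℕ-inject₁ (fromℕ m))) })

extend-earlierLarger⁻ : ∀ {n} {τ : Vec (Fin n) n} {v} →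
  EarlierLargerAtAscents (extend τ v) → EarlierLargerAtAscents τ
extend-earlierLarger⁻ {τ = τ} {v} larger i j j≡1+i τi<τj
  with larger (inject₁ i) (inject₁ j) (from inject₁-adjacent⇔ j≡1+i) (from (extend-<⇔ τ v i j) τi<τj)
... | k , k<i , πi<πk with view k
...   | ‵fromℕ      = contradiction k<i (fromℕ≮ (inject₁ i))
...   | ‵inject₁ k′ = k′ , to inject₁-<⇔ k<i , to (extend-<⇔ τ v i k′) πi<πk

-- The ascent created at the end of an extension is covered by the maximum of τ, which lies
-- earlier unless τ ends with it; and if τ does end with its maximum, a last value v other than
-- the new maximum creates no ascent there.
extend-lastAscent-covered : ∀ {m} {τ : Vec (Fin (suc m)) (suc m)} {v} → IsPerm τ →
  (EndsWithMax τ → v ≢ fromℕ (suc m)) → lookup (extend τ v) (inject₁ (fromℕ m)) < v →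
  ∃ λ k → k < inject₁ (fromℕ m) × lookup (extend τ v) (inject₁ (fromℕ m)) < lookup (extend τ v) k
extend-lastAscent-covered {m} {τ} {v} perm top-allowed ascent with lookup τ (fromℕ m) ≟ fromℕ m
... | yes ends = contradiction (subst (_< v) top≡ ascent) (fromℕ≮ v)
  where
  top≡ : lookup (extend τ v) (inject₁ (fromℕ m)) ≡ fromℕ (suc m)
  top≡ = begin
    lookup (extend τ v) (inject₁ (fromℕ m))  ≡⟨ lookup-extend-inject₁ τ v (fromℕ m) ⟩
    punchIn v (lookup τ (fromℕ m))          ≡⟨ cong (punchIn v) ends ⟩
    punchIn v (fromℕ m)                     ≡⟨ punchIn-fromℕ (top-allowed ends) ⟩
    fromℕ (suc m)                           ∎
    where open ≡-Reasoning
... | no ¬ends with injective⇒surjective (perm _ _) (fromℕ m)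
...   | k , τk≡max = inject₁ k , from inject₁-<⇔ (<fromℕ k≢last) ,
                     from (extend-<⇔ τ v (fromℕ m) k) last<k
  where
  k≢last : k ≢ fromℕ m
  k≢last refl = ¬ends τk≡max
  last<k : lookup τ (fromℕ m) < lookup τ k
  last<k = subst (lookup τ (fromℕ m) <_) (sym τk≡max) (<fromℕ ¬ends)

extend-earlierLarger⁺ : ∀ {n} {τ : Vec (Fin n) n} {v} → IsPerm τ → EarlierLargerAtAscents τ →
  (EndsWithMax τ → v ≢ fromℕ n) → EarlierLargerAtAscents (extend τ v)
extend-earlierLarger⁺ {n} {τ} {v} perm larger top-allowed i j j≡1+i πi<πj with view j
extend-earlierLarger⁺ {zero} perm larger top-allowed i j () πi<πj | ‵fromℕ
extend-earlierLarger⁺ {suc m} {τ} {v} perm larger top-allowed i j j≡1+i πi<πj | ‵fromℕ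
  with to fromℕ-adjacent⇔ j≡1+i
... | refl = extend-lastAscent-covered {τ = τ} perm top-allowed
               (subst (lookup (extend τ v) i <_) (lookup-extend-fromℕ τ v) πi<πj)
extend-earlierLarger⁺ {n} {τ} {v} perm larger top-allowed i j j≡1+i πi<πj | ‵inject₁ j′ with view i
... | ‵fromℕ      = contradiction (adjacent⇒< j≡1+i) (fromℕ≮ _)
... | ‵inject₁ i′ with larger i′ j′ (to inject₁-adjacent⇔ j≡1+i) (to (extend-<⇔ τ v i′ j′) πi<πj)
...   | k , k<i , τi<τk = inject₁ k , from inject₁-<⇔ k<i , from (extend-<⇔ τ v i′ k) τi<τk

-- If τ ends with its maximum, appending the new maximum creates an ascent with nothing larger before it.
extend-fromℕ-earlierLarger⇒¬endsWithMax : ∀ {n} {τ : Vec (Fin n) n} →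
  EarlierLargerAtAscents (extend τ (fromℕ n)) → ¬ EndsWithMax τ
extend-fromℕ-earlierLarger⇒¬endsWithMax {zero} _ ()
extend-fromℕ-earlierLarger⇒¬endsWithMax {suc m} {τ} larger ends
  with larger (inject₁ (fromℕ m)) (fromℕ (suc m)) (from fromℕ-adjacent⇔ refl) ascent
  where
  ascent : lookup (extend τ (fromℕ (suc m))) (inject₁ (fromℕ m)) <
           lookup (extend τ (fromℕ (suc m))) (fromℕ (suc m))
  ascent rewrite lookup-extend-fromℕ τ (fromℕ (suc m)) | lookup-extend-inject₁ τ (fromℕ (suc m)) (fromℕ m) =
    <fromℕ (punchInᵢ≢i _ _)
... | k , k<last , πlast<πk with view k
...   | ‵fromℕ      = fromℕ≮ _ k<last
...   | ‵inject₁ k′ =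
  fromℕ≮ (lookup τ k′) (subst (_< lookup τ k′) ends (to (extend-<⇔ τ _ (fromℕ m) k′) πlast<πk))

extend-earlierLarger⇔ : ∀ {n} (τ : Vec (Fin n) n) v → IsPerm τ →
  EarlierLargerAtAscents (extend τ v) ⇔ (EarlierLargerAtAscents τ × (EndsWithMax τ → v ≢ fromℕ n))
extend-earlierLarger⇔ τ v perm = mk⇔
  (λ larger → extend-earlierLarger⁻ {τ = τ} larger ,
              λ { ends refl → extend-fromℕ-earlierLarger⇒¬endsWithMax {τ = τ} larger ends })
  (λ (larger , top-allowed) → extend-earlierLarger⁺ perm larger top-allowed)

-- Generating the avoiders

concatMap-unique : ∀ {A B : Set} (f : A → List B) {xs} → Unique xs → (∀ x → Unique (f x)) →
  (∀ {x y z} → z ∈ f x → z ∈ f y → x ≡ y) → Unique (concatMap f xs)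
concatMap-unique f {xs} xs-unique f-unique separated = Unique.concat⁺
  (All.map⁺ (All.tabulate λ {x} _ → f-unique x))
  (AllPairs.map⁺ {f = f} (AllPairs.map (λ x≢y {_} (z∈fx , z∈fy) → x≢y (separated z∈fx z∈fy)) xs-unique))

length-concatMap-const : ∀ {A B : Set} (f : A → List B) {k} → (∀ x → length (f x) ≡ k) →
  ∀ xs → length (concatMap f xs) ≡ k * length xs
length-concatMap-const f {k} const [] = sym (ℕ.*-zeroʳ k)
length-concatMap-const f {k} const (x ∷ xs) = begin
  length (f x ++ concatMap f xs)         ≡⟨ length-++ (f x) ⟩
  length (f x) + length (concatMap f xs) ≡⟨ cong₂ _+_ (const x) (length-concatMap-const f const xs) ⟩
  k + k * length xs                      ≡⟨ ℕ.*-suc k (length xs) ⟨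
  k * suc (length xs)                    ∎
  where open ≡-Reasoning

IsAvoider : ∀ {n} → Vec (Fin n) n → Set
IsAvoider π = IsPerm π × EarlierLargerAtAscents π

extensionsBelowMax : ∀ {n} → Vec (Fin n) n → List (Vec (Fin (suc n)) (suc n))
extensionsBelowMax {n} τ = map (extend τ ∘ inject₁) (allFin n)

extendByMax : ∀ {n} → Vec (Fin n) n → Vec (Fin (suc n)) (suc n)
extendByMax {n} τ = extend τ (fromℕ n)

mutual
  avoiders : ∀ n → List (Vec (Fin n) n)
  avoiders zero    = [ Vec.[] ]
  avoiders (suc n) = avoidersNotEndingWithMax (suc n) ++ map extendByMax (avoidersNotEndingWithMax n)

  avoidersNotEndingWithMax : ∀ n → List (Vec (Fin n) n)
  avoidersNotEndingWithMax zero    = [ Vec.[] ]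
  avoidersNotEndingWithMax (suc n) = concatMap extensionsBelowMax (avoiders n)

extend-inject₁-¬endsWithMax : ∀ {n} (τ : Vec (Fin n) n) w → ¬ EndsWithMax (extend τ (inject₁ w))
extend-inject₁-¬endsWithMax τ w = fromℕ≢inject₁ ∘ sym ∘ to (extend-endsWithMax⇔ τ (inject₁ w))

module _ (n : ℕ) where

  ∈-avoidersNotEndingWithMax-suc : (∀ {τ} → τ ∈ avoiders n ⇔ IsAvoider τ) →
    ∀ {π} → π ∈ avoidersNotEndingWithMax (suc n) ⇔ (IsAvoider π × ¬ EndsWithMax π)
  ∈-avoidersNotEndingWithMax-suc ∈ₙ {π} = mk⇔ ⇒ ⇐
    where
    ⇒ : π ∈ avoidersNotEndingWithMax (suc n) → IsAvoider π × ¬ EndsWithMax π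
    ⇒ π∈ with find (∈-concatMap⁻ extensionsBelowMax {xs = avoiders n} π∈)
    ... | τ , τ∈ , π∈′ with ∈-map⁻ _ π∈′ | to ∈ₙ τ∈
    ...   | w , _ , refl | perm , larger =
      (extend-perm τ _ perm , from (extend-earlierLarger⇔ τ _ perm) (larger , λ _ → fromℕ≢inject₁ ∘ sym)) ,
      extend-inject₁-¬endsWithMax τ w
    ⇐ : IsAvoider π × ¬ EndsWithMax π → π ∈ avoidersNotEndingWithMax (suc n)
    ⇐ ((perm , larger) , ¬ends) with extend-surjective {π = π} perm
    ... | τ , v , τ-perm , refl with view v
    ...   | ‵fromℕ      = contradiction (from (extend-endsWithMax⇔ τ _) refl) ¬ends
    ...   | ‵inject₁ w = ∈-concatMap⁺ extensionsBelowMax (lose τ∈ (∈-map⁺ _ (∈-allFin w)))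
      where
      τ∈ : τ ∈ avoiders n
      τ∈ = from ∈ₙ (τ-perm , proj₁ (to (extend-earlierLarger⇔ τ _ τ-perm) larger))

  ∈-avoiders-suc :
    (∀ {τ} → τ ∈ avoidersNotEndingWithMax n ⇔ (IsAvoider τ × ¬ EndsWithMax τ)) →
    (∀ {τ} → τ ∈ avoidersNotEndingWithMax (suc n) ⇔ (IsAvoider τ × ¬ EndsWithMax τ)) →
    ∀ {π} → π ∈ avoiders (suc n) ⇔ IsAvoider π
  ∈-avoiders-suc ∈ₙ ∈ₙ₊₁ {π} = mk⇔ ⇒ ⇐
    where
    ⇒ : π ∈ avoiders (suc n) → IsAvoider π
    ⇒ π∈ with ∈-++⁻ (avoidersNotEndingWithMax (suc n)) π∈
    ... | inj₁ π∈′ = proj₁ (to ∈ₙ₊₁ π∈′)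
    ... | inj₂ π∈′ with ∈-map⁻ _ π∈′
    ...   | τ , τ∈ , refl with to ∈ₙ τ∈
    ...     | (perm , larger) , ¬ends =
      extend-perm τ _ perm , from (extend-earlierLarger⇔ τ _ perm) (larger , λ ends _ → ¬ends ends)
    ⇐ : IsAvoider π → π ∈ avoiders (suc n)
    ⇐ (perm , larger) with extend-surjective {π = π} perm
    ... | τ , v , τ-perm , refl with view v | to (extend-earlierLarger⇔ τ v τ-perm) larger
    ...   | ‵fromℕ      | τ-larger , top-allowed =
      ∈-++⁺ʳ _ (∈-map⁺ _ (from ∈ₙ ((τ-perm , τ-larger) , λ ends → top-allowed ends refl)))
    ...   | ‵inject₁ w | _ =
      ∈-++⁺ˡ (from ∈ₙ₊₁ ((perm , larger) , extend-inject₁-¬endsWithMax τ w))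

mutual
  ∈-avoiders : ∀ n {π : Vec (Fin n) n} → π ∈ avoiders n ⇔ IsAvoider π
  ∈-avoiders zero {Vec.[]} = mk⇔ (λ _ → (λ ()) , (λ ())) (λ _ → here refl)
  ∈-avoiders (suc n) = ∈-avoiders-suc n (∈-avoidersNotEndingWithMax n) (∈-avoidersNotEndingWithMax (suc n))

  ∈-avoidersNotEndingWithMax : ∀ n {π : Vec (Fin n) n} →
    π ∈ avoidersNotEndingWithMax n ⇔ (IsAvoider π × ¬ EndsWithMax π)
  ∈-avoidersNotEndingWithMax zero {Vec.[]} = mk⇔ (λ _ → ((λ ()) , (λ ())) , (λ ())) (λ _ → here refl)
  ∈-avoidersNotEndingWithMax (suc n) = ∈-avoidersNotEndingWithMax-suc n (∈-avoiders n)

extensionsBelowMax-unique : ∀ {n} (τ : Vec (Fin n) n) → Unique (extensionsBelowMax τ)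
extensionsBelowMax-unique {n} τ = Unique.map⁺ (inject₁-injective ∘ proj₂ ∘ extend-injective) (allFin⁺ n)

extensionsBelowMax-disjoint : ∀ {n} {τ τ′ : Vec (Fin n) n} {π} →
  π ∈ extensionsBelowMax τ → π ∈ extensionsBelowMax τ′ → τ ≡ τ′
extensionsBelowMax-disjoint π∈ π∈′ with ∈-map⁻ _ π∈ | ∈-map⁻ _ π∈′
... | _ , _ , refl | _ , _ , eq = proj₁ (extend-injective eq)

mutual
  avoiders-unique : ∀ n → Unique (avoiders n)
  avoiders-unique zero    = All.[] ∷ []
  avoiders-unique (suc n) = Unique.++⁺ (avoidersNotEndingWithMax-unique (suc n))
    (Unique.map⁺ (proj₁ ∘ extend-injective) (avoidersNotEndingWithMax-unique n))
    (λ (π∈ , π∈′) → proj₂ (to (∈-avoidersNotEndingWithMax (suc n)) π∈) (endsWithMax π∈′))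
    where
    endsWithMax : ∀ {π} → π ∈ map extendByMax (avoidersNotEndingWithMax n) → EndsWithMax π
    endsWithMax π∈ with ∈-map⁻ _ π∈
    ... | τ , _ , refl = from (extend-endsWithMax⇔ τ _) refl

  avoidersNotEndingWithMax-unique : ∀ n → Unique (avoidersNotEndingWithMax n)
  avoidersNotEndingWithMax-unique zero    = All.[] ∷ []
  avoidersNotEndingWithMax-unique (suc n) =
    concatMap-unique extensionsBelowMax (avoiders-unique n) extensionsBelowMax-unique extensionsBelowMax-disjoint

length-avoidersNotEndingWithMax : ∀ n → length (avoidersNotEndingWithMax (suc n)) ≡ n * length (avoiders n)
length-avoidersNotEndingWithMax n = length-concatMap-const extensionsBelowMax length-extensions (avoiders n)
  where
  length-extensions : ∀ τ → length (extensionsBelowMax τ) ≡ n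
  length-extensions τ = trans (length-map _ (allFin n)) (length-tabulate (λ i → i))

length-avoiders : ∀ n → length (avoiders (2 + n)) ≡ suc n * length (avoiders (suc n)) + n * length (avoiders n)
length-avoiders n = begin
  length (avoidersNotEndingWithMax (2 + n) ++ map extendByMax (avoidersNotEndingWithMax (suc n)))
    ≡⟨ length-++ (avoidersNotEndingWithMax (2 + n)) ⟩
  length (avoidersNotEndingWithMax (2 + n)) + length (map extendByMax (avoidersNotEndingWithMax (suc n)))
    ≡⟨ cong (λ l → length (avoidersNotEndingWithMax (2 + n)) + l) (length-map _ (avoidersNotEndingWithMax (suc n))) ⟩
  length (avoidersNotEndingWithMax (2 + n)) + length (avoidersNotEndingWithMax (suc n))
    ≡⟨ cong₂ _+_ (length-avoidersNotEndingWithMax (suc n)) (length-avoidersNotEndingWithMax n) ⟩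
  suc n * length (avoiders (suc n)) + n * length (avoiders n) ∎
  where open ≡-Reasoning

avoiderCount : ∀ n → AvoiderCount Rp n (length (avoiders n))
avoiderCount n = avoiders n , avoiders-unique n , (λ π → ⇔.trans (∈-avoiders n) (isAvoider⇔ π)) , refl
  where
  isAvoider⇔ : ∀ π → IsAvoider π ⇔ (IsPerm π × Avoids12 Rp π)
  isAvoider⇔ π = mk⇔ (λ (perm , larger) → perm , from (avoids⇔earlierLargerAtAscents π perm) larger)
                     (λ (perm , avoids) → perm , to (avoids⇔earlierLargerAtAscents π perm) avoids)

-- Derangement numbers and the alternating sum

∑< : ℕ → (ℕ → ℤ) → ℤ
∑< n f = sum {n} (f ∘ toℕ)

sumℤ-map-applyUpTo : ∀ n (f : ℕ → ℤ) (g : ℕ → ℕ) → sumℤ (map f (applyUpTo g n)) ≡ ∑< n (f ∘ g)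
sumℤ-map-applyUpTo zero    f g = refl
sumℤ-map-applyUpTo (suc n) f g = cong (ℤ._+_ (f (g 0))) (sumℤ-map-applyUpTo n f (g ∘ suc))

∑<-suc : ∀ n (f : ℕ → ℤ) → ∑< (suc n) f ≡ ∑< n f ℤ.+ f n
∑<-suc n f = begin
  ∑< (suc n) f
    ≡⟨ sum-init-last {n} (f ∘ toℕ) ⟩
  sum {n} (f ∘ toℕ ∘ inject₁) ℤ.+ f (toℕ (fromℕ n))
    ≡⟨ cong₂ ℤ._+_ (sum-cong-≗ {n} (cong f ∘ toℕ-inject₁)) (cong f (toℕ-fromℕ n)) ⟩
  ∑< n f ℤ.+ f n ∎
  where open ≡-Reasoning

∑<-cong : ∀ n {f g : ℕ → ℤ} → (∀ k → k ℕ.< n → f k ≡ g k) → ∑< n f ≡ ∑< n g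
∑<-cong n {f} {g} f≗g = sum-cong-≗ {n} (λ i → f≗g (toℕ i) (toℕ<n i))

factQuot-diag : ∀ m → factQuot m m ≡ 1
factQuot-diag m = n/n≡1 (m !) {{m ℕ.!≢0}}

factQuot-suc : ∀ {m k} → k ℕ.≤ m → factQuot (suc m) k ≡ suc m ℕ.* factQuot m k
factQuot-suc {m} {k} k≤m = *-/-assoc (suc m) {{k ℕ.!≢0}} (m≤n⇒m!∣n! k≤m)

sign : ℕ → ℤ
sign k = -[1+ 0 ] ℤ.^ k

derangementTerm : ℕ → ℕ → ℤ
derangementTerm m k = sign k ℤ.* + factQuot m k

derangements : ℕ → ℤ
derangements m = ∑< (suc m) (derangementTerm m)

derangements-suc : ∀ m → derangements (suc m) ≡ + suc m ℤ.* derangements m ℤ.+ sign (suc m)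
derangements-suc m = begin
  ∑< (suc (suc m)) (derangementTerm (suc m))
    ≡⟨ ∑<-suc (suc m) (derangementTerm (suc m)) ⟩
  ∑< (suc m) (derangementTerm (suc m)) ℤ.+ derangementTerm (suc m) (suc m)
    ≡⟨ cong₂ ℤ._+_ (∑<-cong (suc m) scaled) last ⟩
  ∑< (suc m) (λ k → + suc m ℤ.* derangementTerm m k) ℤ.+ sign (suc m)
    ≡⟨ cong (ℤ._+ sign (suc m)) (*-distribˡ-sum {suc m} (+ suc m) (derangementTerm m ∘ toℕ)) ⟨
  + suc m ℤ.* derangements m ℤ.+ sign (suc m) ∎
  where
  open ≡-Reasoning
  scaled : ∀ k → k ℕ.< suc m → derangementTerm (suc m) k ≡ + suc m ℤ.* derangementTerm m k
  scaled k k<1+m = begin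
    sign k ℤ.* + factQuot (suc m) k
      ≡⟨ cong (λ q → sign k ℤ.* + q) (factQuot-suc (ℕ.s≤s⁻¹ k<1+m)) ⟩
    sign k ℤ.* + (suc m ℕ.* factQuot m k)
      ≡⟨ cong (sign k ℤ.*_) (ℤ.pos-* (suc m) (factQuot m k)) ⟩
    sign k ℤ.* (+ suc m ℤ.* + factQuot m k)
      ≡⟨ x∙yz≈y∙xz (sign k) (+ suc m) _ ⟩
    + suc m ℤ.* (sign k ℤ.* + factQuot m k) ∎
  last : derangementTerm (suc m) (suc m) ≡ sign (suc m)
  last = trans (cong (λ q → sign (suc m) ℤ.* + q) (factQuot-diag (suc m))) (ℤ.*-identityʳ (sign (suc m)))

derangements-suc-suc : ∀ m → derangements (suc (suc m)) ≡ + suc m ℤ.* (derangements (suc m) ℤ.+ derangements m)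
derangements-suc-suc m = begin
  derangements (suc (suc m))
    ≡⟨ derangements-suc (suc m) ⟩
  + suc (suc m) ℤ.* derangements (suc m) ℤ.+ sign (suc (suc m))
    ≡⟨ cong (λ d → + suc (suc m) ℤ.* d ℤ.+ sign (suc (suc m))) (derangements-suc m) ⟩
  + suc (suc m) ℤ.* (+ suc m ℤ.* derangements m ℤ.+ sign (suc m)) ℤ.+ sign (suc (suc m))
    ≡⟨ regroup (+ suc m) (derangements m) (sign (suc m)) ⟩
  + suc m ℤ.* ((+ suc m ℤ.* derangements m ℤ.+ sign (suc m)) ℤ.+ derangements m)
    ≡⟨ cong (λ d → + suc m ℤ.* (d ℤ.+ derangements m)) (derangements-suc m) ⟨
  + suc m ℤ.* (derangements (suc m) ℤ.+ derangements m) ∎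
  where
  open ≡-Reasoning
  -- + suc (suc m) and sign (suc (suc m)) compute to + 1 ℤ.+ + suc m and -[1+ 0 ] ℤ.* sign (suc m).
  regroup : ∀ M d s →
    (+ 1 ℤ.+ M) ℤ.* (M ℤ.* d ℤ.+ s) ℤ.+ -[1+ 0 ] ℤ.* s ≡ M ℤ.* ((M ℤ.* d ℤ.+ s) ℤ.+ d)
  regroup = solve-∀

formulaTerm : ℕ → ℕ → ℤ
formulaTerm m k = sign k ℤ.* + (suc m ∸ k) ℤ.* + factQuot m k

formula-∑< : ∀ m → formula (suc m) ≡ ∑< (suc m) (formulaTerm m)
formula-∑< m = sumℤ-map-applyUpTo (suc m) (formulaTerm m) (λ k → k)

formula-suc-suc : ∀ m →
  formula (suc (suc m)) ≡ + suc m ℤ.* (formula (suc m) ℤ.+ derangements m) ℤ.+ sign (suc m)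
formula-suc-suc m = begin
  formula (suc (suc m))
    ≡⟨ formula-∑< (suc m) ⟩
  ∑< (suc (suc m)) (formulaTerm (suc m))
    ≡⟨ ∑<-suc (suc m) (formulaTerm (suc m)) ⟩
  ∑< (suc m) (formulaTerm (suc m)) ℤ.+ formulaTerm (suc m) (suc m)
    ≡⟨ cong₂ ℤ._+_ (∑<-cong (suc m) split) last ⟩
  ∑< (suc m) (λ k → + suc m ℤ.* termSum k) ℤ.+ sign (suc m)
    ≡⟨ cong (ℤ._+ sign (suc m)) (*-distribˡ-sum {suc m} (+ suc m) (termSum ∘ toℕ)) ⟨
  + suc m ℤ.* ∑< (suc m) termSum ℤ.+ sign (suc m)
    ≡⟨ cong (λ t → + suc m ℤ.* t ℤ.+ sign (suc m))
            (∑-distrib-+ {suc m} (formulaTerm m ∘ toℕ) (derangementTerm m ∘ toℕ)) ⟩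
  + suc m ℤ.* (∑< (suc m) (formulaTerm m) ℤ.+ derangements m) ℤ.+ sign (suc m)
    ≡⟨ cong (λ t → + suc m ℤ.* (t ℤ.+ derangements m) ℤ.+ sign (suc m)) (formula-∑< m) ⟨
  + suc m ℤ.* (formula (suc m) ℤ.+ derangements m) ℤ.+ sign (suc m) ∎
  where
  open ≡-Reasoning
  termSum : ℕ → ℤ
  termSum k = formulaTerm m k ℤ.+ derangementTerm m k
  split : ∀ k → k ℕ.< suc m → formulaTerm (suc m) k ≡ + suc m ℤ.* termSum k
  split k k<1+m = begin
    sign k ℤ.* + (suc (suc m) ∸ k) ℤ.* + factQuot (suc m) k
      ≡⟨ cong₂ (λ c q → sign k ℤ.* + c ℤ.* + q)
               (ℕ.+-∸-assoc 1 (ℕ.<⇒≤ k<1+m)) (factQuot-suc (ℕ.s≤s⁻¹ k<1+m)) ⟩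
    sign k ℤ.* (+ 1 ℤ.+ + (suc m ∸ k)) ℤ.* + (suc m ℕ.* factQuot m k)
      ≡⟨ cong (sign k ℤ.* (+ 1 ℤ.+ + (suc m ∸ k)) ℤ.*_) (ℤ.pos-* (suc m) (factQuot m k)) ⟩
    sign k ℤ.* (+ 1 ℤ.+ + (suc m ∸ k)) ℤ.* (+ suc m ℤ.* + factQuot m k)
      ≡⟨ expand (sign k) (+ (suc m ∸ k)) (+ suc m) (+ factQuot m k) ⟩
    + suc m ℤ.* (sign k ℤ.* + (suc m ∸ k) ℤ.* + factQuot m k ℤ.+ sign k ℤ.* + factQuot m k) ∎
    where
    expand : ∀ s c M q → s ℤ.* (+ 1 ℤ.+ c) ℤ.* (M ℤ.* q) ≡ M ℤ.* (s ℤ.* c ℤ.* q ℤ.+ s ℤ.* q)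
    expand = solve-∀
  last : formulaTerm (suc m) (suc m) ≡ sign (suc m)
  last = begin
    sign (suc m) ℤ.* + (suc (suc m) ∸ suc m) ℤ.* + factQuot (suc m) (suc m)
      ≡⟨ cong₂ (λ c q → sign (suc m) ℤ.* + c ℤ.* + q) (ℕ.m+n∸n≡m 1 (suc m)) (factQuot-diag (suc m)) ⟩
    sign (suc m) ℤ.* + 1 ℤ.* + 1
      ≡⟨ trans (ℤ.*-identityʳ _) (ℤ.*-identityʳ _) ⟩
    sign (suc m) ∎

formula≡derangements : ∀ m → formula (suc m) ≡ derangements m ℤ.+ derangements (suc m)
formula≡derangements zero    = refl
formula≡derangements (suc m) = begin
  formula (suc (suc m))
    ≡⟨ formula-suc-suc m ⟩
  + suc m ℤ.* (formula (suc m) ℤ.+ derangements m) ℤ.+ sign (suc m)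
    ≡⟨ cong (λ f → + suc m ℤ.* (f ℤ.+ derangements m) ℤ.+ sign (suc m)) (formula≡derangements m) ⟩
  + suc m ℤ.* ((derangements m ℤ.+ derangements (suc m)) ℤ.+ derangements m) ℤ.+ sign (suc m)
    ≡⟨ regroup (+ suc m) (derangements m) (derangements (suc m)) (sign (suc m)) ⟩
  (+ suc m ℤ.* derangements m ℤ.+ sign (suc m)) ℤ.+ + suc m ℤ.* (derangements (suc m) ℤ.+ derangements m)
    ≡⟨ cong₂ ℤ._+_ (derangements-suc m) (derangements-suc-suc m) ⟨
  derangements (suc m) ℤ.+ derangements (suc (suc m)) ∎
  where
  open ≡-Reasoning
  regroup : ∀ M d d′ s → M ℤ.* ((d ℤ.+ d′) ℤ.+ d) ℤ.+ s ≡ (M ℤ.* d ℤ.+ s) ℤ.+ M ℤ.* (d′ ℤ.+ d)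
  regroup = solve-∀

second-order-recurrence-unique : ∀ {A : Set} (step : ℕ → A → A → A) {f g : ℕ → A} →
  f 0 ≡ g 0 → f 1 ≡ g 1 →
  (∀ m → f (suc (suc m)) ≡ step m (f (suc m)) (f m)) →
  (∀ m → g (suc (suc m)) ≡ step m (g (suc m)) (g m)) →
  ∀ m → f m ≡ g m
second-order-recurrence-unique step {f} {g} f₀ f₁ f-rec g-rec m = proj₁ (agree m)
  where
  agree : ∀ m → f m ≡ g m × f (suc m) ≡ g (suc m)
  agree zero    = f₀ , f₁
  agree (suc m) = let fₘ , fₘ₊₁ = agree m in
    fₘ₊₁ , trans (f-rec m) (trans (cong₂ (step m) fₘ₊₁ fₘ) (sym (g-rec m)))

length-avoiders≡derangements : ∀ m → + length (avoiders (suc m)) ≡ derangements m ℤ.+ derangements (suc m)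
length-avoiders≡derangements = second-order-recurrence-unique step refl refl avoiders-rec derangements-rec
  where
  ℓ : ℕ → ℕ
  ℓ k = length (avoiders k)
  D : ℕ → ℤ
  D = derangements
  step : ℕ → ℤ → ℤ → ℤ
  step m x y = + suc (suc m) ℤ.* x ℤ.+ + suc m ℤ.* y
  avoiders-rec : ∀ m → + ℓ (3 + m) ≡ step m (+ ℓ (2 + m)) (+ ℓ (suc m))
  avoiders-rec m = begin
    + ℓ (3 + m)
      ≡⟨ cong +_ (length-avoiders (suc m)) ⟩
    + (suc (suc m) * ℓ (2 + m) + suc m * ℓ (suc m))
      ≡⟨ ℤ.pos-+ (suc (suc m) * ℓ (2 + m)) (suc m * ℓ (suc m)) ⟩
    + (suc (suc m) * ℓ (2 + m)) ℤ.+ + (suc m * ℓ (suc m))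
      ≡⟨ cong₂ ℤ._+_ (ℤ.pos-* (suc (suc m)) (ℓ (2 + m))) (ℤ.pos-* (suc m) (ℓ (suc m))) ⟩
    step m (+ ℓ (2 + m)) (+ ℓ (suc m)) ∎
    where open ≡-Reasoning
  derangements-rec : ∀ m → D (2 + m) ℤ.+ D (3 + m) ≡ step m (D (suc m) ℤ.+ D (2 + m)) (D m ℤ.+ D (suc m))
  derangements-rec m = begin
    D (2 + m) ℤ.+ D (3 + m)
      ≡⟨ cong₂ ℤ._+_ (derangements-suc-suc m) (derangements-suc-suc (suc m)) ⟩
    + suc m ℤ.* (D (suc m) ℤ.+ D m) ℤ.+ + suc (suc m) ℤ.* (D (2 + m) ℤ.+ D (suc m))
      ≡⟨ regroup (+ suc m) (+ suc (suc m)) (D m) (D (suc m)) (D (2 + m)) ⟩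
    step m (D (suc m) ℤ.+ D (2 + m)) (D m ℤ.+ D (suc m)) ∎
    where
    open ≡-Reasoning
    regroup : ∀ M M′ d₀ d₁ d₂ →
      M ℤ.* (d₁ ℤ.+ d₀) ℤ.+ M′ ℤ.* (d₂ ℤ.+ d₁) ≡ M′ ℤ.* (d₁ ℤ.+ d₂) ℤ.+ M ℤ.* (d₀ ℤ.+ d₁)
    regroup = solve-∀

proposition4p9 : (∀ (n : ℕ) (π : Vec (Fin n) n) → IsPerm π → (Avoids12 Rp π ⇔ AscentCondition π))
    × Σ (ℕ → ℕ) (λ a →
    (∀ n → AvoiderCount Rp n (a n))
    × a 0 ≡ 1 × a 1 ≡ 1
    × (∀ n → n ≥ 2 → a n ≡ (n ∸ 1) * a (n ∸ 1) + (n ∸ 2) * a (n ∸ 2))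
    × (∀ n → n ≥ 1 → + (a n) ≡ formula n))
proposition4p9 =
  (λ _ → avoids⇔ascentCondition) ,
  length ∘ avoiders , avoiderCount , refl , refl , recurrence , closed-form
  where
  recurrence : ∀ n → n ≥ 2 →
    length (avoiders n) ≡ (n ∸ 1) * length (avoiders (n ∸ 1)) + (n ∸ 2) * length (avoiders (n ∸ 2))
  recurrence (suc (suc n)) _       = length-avoiders n
  recurrence (suc zero)    (s≤s ())
  closed-form : ∀ n → n ≥ 1 → + length (avoiders n) ≡ formula n
  closed-form (suc m) _ = trans (length-avoiders≡derangements m) (sym (formula≡derangements m))
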